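{- Let $0\le e_1\le e_2\le\cdots\le e_m\le n$ and let $A(e_1,\dots,e_m)=[a_{ij}]$ be an $m\times n$ $(0,1)$-staircase matrix which is $12$-avoiding. Then the number of $1$'s in $A$ is at most $\max\{e_i+m-i : 1\le i\le m\}$.
   Context: For $0\le e_1\le\cdots\le e_m\le n$, the $m\times n$ staircase array $A(e_1,\dots,e_m)$ is the set of positions of an $m\times n$ array in which row $i$ consists only of its first (leftmost) $e_i$ positions $(i,1),\dots,(i,e_i)$; the positions $(i,j)$ with $j>e_i$ are removed, so a partition-shaped set of positions is removed from the upper right corner. A $(0,1)$-staircase matrix is such an array with a $0$ or $1$ in each (non-removed) position. It is $12$-avoiding if there are no positions $(i,j),(i',j')$ with $i<i'$, $j<j'$ both containing $1$. -}

module Defs where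

open import Data.Nat using (ℕ; zero; suc; _+_; _∸_; _≤_; _<_; _⊔_)
open import Data.Fin using (Fin; toℕ; _<_)
open import Data.Bool using (Bool; true; false)
open import Data.Product using (_×_)
open import Relation.Binary.PropositionalEquality using (_≡_)
open import Relation.Nullary using (¬_)

∑ : ∀ {k} → (Fin k → ℕ) → ℕ
∑ {zero} f = 0
∑ {suc k} f = f Fin.zero + ∑ (λ i → f (Fin.suc i))

max : ∀ {k} → (Fin k → ℕ) → ℕ
max {zero} f = 0
max {suc k} f = f Fin.zero ⊔ max (λ i → f (Fin.suc i))

-- Staircase shape: e i is the length of row i (rows/columns 0-indexed),
-- 0 ≤ e_1 ≤ ... ≤ e_m ≤ n.
IsStaircase : (m n : ℕ) → (Fin m → ℕ) → Set
IsStaircase m n e = (∀ (i i' : Fin m) → toℕ i Data.Nat.≤ toℕ i' → e i Data.Nat.≤ e i')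
                  × (∀ (i : Fin m) → e i Data.Nat.≤ n)

InShape : ∀ {m n} → (Fin m → ℕ) → Fin m → Fin n → Set
InShape e i j = toℕ j Data.Nat.< e i

-- A (0,1)-staircase matrix is given by a : Fin m → Fin n → Bool; the values at
-- removed positions (outside the shape) are irrelevant and ignored below.
-- 12-avoiding: no (i,j),(i',j') in the shape with i<i', j<j' both containing 1.
Avoids12 : ∀ {m n} → (Fin m → ℕ) → (Fin m → Fin n → Bool) → Set
Avoids12 e a = ∀ i i' j j' → i Data.Fin.< i' → j Data.Fin.< j' →
  InShape e i j → InShape e i' j' →
  ¬ (a i j ≡ true × a i' j' ≡ true)

entry : ∀ {m n} → (Fin m → ℕ) → (Fin m → Fin n → Bool) → Fin m → Fin n → ℕ
entry e a i j with toℕ j Data.Nat.<? e i | a i j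
... | Relation.Nullary.yes _ | true = 1
... | _ | _ = 0

ones : ∀ {m n} → (Fin m → ℕ) → (Fin m → Fin n → Bool) → ℕ
ones e a = ∑ (λ i → ∑ (λ j → entry e a i j))

module Submission where

-- Proof idea.  Forget the staircase shape and work with an arbitrary
-- 12-avoiding (0,1)-matrix M whose ones in row i lie in the first E i columns.
--
-- * Interval bound: a (0,1)-row whose ones lie in k consecutive columns has at
--   most k ones.
-- * Column-bounded bound: if all ones of an m-row avoiding matrix lie in columns
--   ≤ c, it has at most c + m ones.  By induction on m: if the top row has its
--   leftmost one in column ℓ, then avoidance forces every one below it into
--   columns ≤ ℓ, so the top row contributes ≤ c + 1 - ℓ and the rest ≤ ℓ + (m-1).
-- * Row-length bound: if the top row is empty, drop it; otherwise its one in
--   column ℓ < E 0 confines the whole matrix to columns ≤ E 0 - 1, and the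
--   column-bounded bound gives E 0 + (m - 1), one of the terms of the maximum.
-- The theorem follows by viewing the entries of A (inside the shape) as M.

open import Defs
open import Data.Nat using (ℕ; suc; _+_; _∸_; _≤_)
open import Data.Fin using (Fin; toℕ)
open import Data.Bool using (Bool)

open import Data.Nat using (zero; pred; _<_; _<?_; _≟_; _≤?_; z≤n; s≤s; s≤s⁻¹)
open import Data.Nat.Properties
open import Data.Fin using () renaming (zero to fz; suc to fs)
open import Data.Bool using (true; false)
open import Data.Product using (_×_; _,_; proj₁; proj₂)
open import Data.Empty using (⊥; ⊥-elim)
open import Relation.Nullary using (yes; no)
open import Relation.Binary.PropositionalEquality

Matrix : ℕ → ℕ → Set
Matrix m n = Fin m → Fin n → ℕ

ZeroOne : ∀ {m n} → Matrix m n → Set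
ZeroOne M = ∀ i j → M i j ≤ 1

Avoiding : ∀ {m n} → Matrix m n → Set
Avoiding M = ∀ i i' j j' → toℕ i < toℕ i' → toℕ j < toℕ j' →
  M i j ≡ 1 → M i' j' ≡ 1 → ⊥

total : ∀ {m n} → Matrix m n → ℕ
total M = ∑ (λ i → ∑ (M i))

lower : ∀ {m n} → Matrix (suc m) n → Matrix m n
lower M i = M (fs i)

zeroOne-lower : ∀ {m n} (M : Matrix (suc m) n) → ZeroOne M → ZeroOne (lower M)
zeroOne-lower M b i = b (fs i)

avoiding-lower : ∀ {m n} (M : Matrix (suc m) n) → Avoiding M → Avoiding (lower M)
avoiding-lower M av i i' j j' i<i' = av (fs i) (fs i') j j' (s≤s i<i')

-- Dropping the first column shifts an interval of columns one step to the left.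
shift-interval : ∀ ℓ k {x} → ℓ ≤ suc x × suc x < ℓ + k → pred ℓ ≤ x × x < pred ℓ + k
shift-interval zero    k (_ , x<k)       = z≤n , <-trans (n<1+n _) x<k
shift-interval (suc ℓ) k (ℓ≤x , x<ℓ+k) = s≤s⁻¹ ℓ≤x , s≤s⁻¹ x<ℓ+k

-- Induction on the row: an entry 0 in column 0 shifts the interval, an entry 1
-- there forces ℓ = 0 and uses up one column of the interval.
interval-bound : ∀ {n} (r : Fin n → ℕ) → (∀ j → r j ≤ 1) → ∀ ℓ k →
  (∀ j → r j ≡ 1 → ℓ ≤ toℕ j × toℕ j < ℓ + k) → ∑ r ≤ k
interval-bound {zero} r b ℓ k inside = z≤n
interval-bound {suc n} r b ℓ k inside with r fz | b fz | inside fz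
... | suc (suc _) | s≤s () | _
... | 0 | _ | _ = interval-bound (λ j → r (fs j)) (λ j → b (fs j)) (pred ℓ) k
                   (λ j one → shift-interval ℓ k (inside (fs j) one))
... | 1 | _ | at0 with ℓ | k | at0 refl
...   | suc _ | _     | () , _
...   | zero  | zero  | _ , ()
...   | zero  | suc k | _ =
  s≤s (interval-bound (λ j → r (fs j)) (λ j → b (fs j)) 0 k
        (λ j one → z≤n , s≤s⁻¹ (proj₂ (inside (fs j) one))))

data LeftmostOne {n} (r : Fin n → ℕ) : Set where
  no-one   : (∀ j → r j ≡ 1 → ⊥) → LeftmostOne r
  leftmost : (ℓ : Fin n) → r ℓ ≡ 1 → (∀ j → r j ≡ 1 → toℕ ℓ ≤ toℕ j) → LeftmostOne r

leftmostOne : ∀ {n} (r : Fin n → ℕ) → LeftmostOne r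
leftmostOne {zero} r = no-one (λ ())
leftmostOne {suc n} r with r fz ≟ 1
... | yes one = leftmost fz one (λ j _ → z≤n)
... | no ¬one with leftmostOne (λ j → r (fs j))
...   | no-one none = no-one λ { fz one → ¬one one ; (fs j) one → none j one }
...   | leftmost ℓ one first =
  leftmost (fs ℓ) one λ { fz one′ → ⊥-elim (¬one one′) ; (fs j) one′ → s≤s (first j one′) }

empty-row : ∀ {n} (r : Fin n → ℕ) → (∀ j → r j ≤ 1) → (∀ j → r j ≡ 1 → ⊥) → ∑ r ≤ 0
empty-row r b none = interval-bound r b 0 0 (λ j one → ⊥-elim (none j one))

below-top : ∀ {m n} (M : Matrix (suc m) n) → Avoiding M → ∀ ℓ → M fz ℓ ≡ 1 →
  ∀ i j → lower M i j ≡ 1 → toℕ j ≤ toℕ ℓ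
below-top M av ℓ top i j one with toℕ j ≤? toℕ ℓ
... | yes j≤ℓ = j≤ℓ
... | no j≰ℓ = ⊥-elim (av fz (fs i) ℓ j (s≤s z≤n) (≰⇒> j≰ℓ) top one)

column-bound : ∀ {m n} (M : Matrix m n) → ZeroOne M → Avoiding M → ∀ c →
  (∀ i j → M i j ≡ 1 → toℕ j ≤ c) → total M ≤ c + m
column-bound {zero} M b av c bounded = z≤n
column-bound {suc m} {n} M b av c bounded with leftmostOne (M fz)
... | no-one none = begin
  ∑ (M fz) + total (lower M) ≤⟨ +-mono-≤ (empty-row (M fz) (b fz) none) rest ⟩
  c + m                      ≤⟨ m≤n+m (c + m) 1 ⟩
  suc (c + m)                ≡⟨ +-suc c m ⟨
  c + suc m                  ∎
  where
  open ≤-Reasoning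
  rest : total (lower M) ≤ c + m
  rest = column-bound (lower M) (zeroOne-lower M b) (avoiding-lower M av) c
           (λ i → bounded (fs i))
... | leftmost ℓ top first = begin
  ∑ (M fz) + total (lower M)   ≤⟨ +-mono-≤ top-row rest ⟩
  (suc c ∸ toℕ ℓ) + (toℕ ℓ + m) ≡⟨ +-assoc (suc c ∸ toℕ ℓ) (toℕ ℓ) m ⟨
  (suc c ∸ toℕ ℓ) + toℕ ℓ + m   ≡⟨ cong (_+ m) (m∸n+n≡m ℓ≤1+c) ⟩
  suc c + m                     ≡⟨ +-suc c m ⟨
  c + suc m                     ∎
  where
  open ≤-Reasoning
  ℓ≤1+c : toℕ ℓ ≤ suc c
  ℓ≤1+c = m≤n⇒m≤1+n (bounded fz ℓ top)
  -- The top row's ones lie in columns ℓ, …, c.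
  top-row : ∑ (M fz) ≤ suc c ∸ toℕ ℓ
  top-row = interval-bound (M fz) (b fz) (toℕ ℓ) (suc c ∸ toℕ ℓ)
    (λ j one → first j one ,
               subst (toℕ j <_) (sym (m+[n∸m]≡n ℓ≤1+c)) (s≤s (bounded fz j one)))
  rest : total (lower M) ≤ toℕ ℓ + m
  rest = column-bound (lower M) (zeroOne-lower M b) (avoiding-lower M av) (toℕ ℓ)
           (below-top M av ℓ top)

row-length-bound : ∀ {m n} (M : Matrix m n) (E : Fin m → ℕ) → ZeroOne M → Avoiding M →
  (∀ i j → M i j ≡ 1 → toℕ j < E i) →
  total M ≤ max (λ i → E i + (m ∸ suc (toℕ i)))
row-length-bound {zero} M E b av inRow = z≤n
row-length-bound {suc m} M E b av inRow with leftmostOne (M fz)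
... | no-one none = begin
  ∑ (M fz) + total (lower M)
    ≤⟨ +-mono-≤ (empty-row (M fz) (b fz) none)
         (row-length-bound (lower M) (λ i → E (fs i)) (zeroOne-lower M b)
           (avoiding-lower M av) (λ i → inRow (fs i))) ⟩
  max (λ i → E (fs i) + (m ∸ suc (toℕ i)))
    ≤⟨ m≤n⊔m (E fz + m) _ ⟩
  max (λ i → E i + (suc m ∸ suc (toℕ i))) ∎
  where open ≤-Reasoning
... | leftmost ℓ top _ = begin
  total M          ≤⟨ column-bound M b av (pred (E fz)) confined ⟩
  pred (E fz) + suc m ≡⟨ pred-+-suc (inRow fz ℓ top) ⟩
  E fz + m         ≤⟨ m≤m⊔n (E fz + m) _ ⟩
  max (λ i → E i + (suc m ∸ suc (toℕ i))) ∎
  where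
  open ≤-Reasoning
  -- All ones lie in columns < E 0: in the top row by assumption, below it
  -- because they are weakly left of the top row's one at column ℓ < E 0.
  confined : ∀ i j → M i j ≡ 1 → toℕ j ≤ pred (E fz)
  confined fz     j one = <⇒≤pred (inRow fz j one)
  confined (fs i) j one = <⇒≤pred (≤-<-trans (below-top M av ℓ top i j one) (inRow fz ℓ top))
  pred-+-suc : ∀ {x y} → y < x → pred x + suc m ≡ x + m
  pred-+-suc {suc x} _ = +-suc x m

entry-zeroOne : ∀ {m n} (e : Fin m → ℕ) (a : Fin m → Fin n → Bool) → ZeroOne (entry e a)
entry-zeroOne e a i j with toℕ j <? e i | a i j
... | yes _ | true  = s≤s z≤n
... | yes _ | false = z≤n
... | no _  | _     = z≤n

entry-one : ∀ {m n} (e : Fin m → ℕ) (a : Fin m → Fin n → Bool) i j → entry e a i j ≡ 1 →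
  InShape e i j × a i j ≡ true
entry-one e a i j one with toℕ j <? e i | a i j
... | yes inShape | true  = inShape , refl
... | yes _       | false = ⊥-elim (0≢1+n one)
... | no _        | _     = ⊥-elim (0≢1+n one)

entry-avoiding : ∀ {m n} (e : Fin m → ℕ) (a : Fin m → Fin n → Bool) →
  Avoids12 e a → Avoiding (entry e a)
entry-avoiding e a av i i' j j' i<i' j<j' one one' =
  let (inShape , a≡1)   = entry-one e a i j one
      (inShape' , a'≡1) = entry-one e a i' j' one'
  in av i i' j j' i<i' j<j' inShape inShape' (a≡1 , a'≡1)

lemma2p3 : (m n : ℕ) (e : Fin m → ℕ) (a : Fin m → Fin n → Bool) →
    IsStaircase m n e → Avoids12 e a →
    ones e a ≤ max (λ i → e i + (m ∸ suc (toℕ i)))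
lemma2p3 m n e a _ av =
  row-length-bound (entry e a) e (entry-zeroOne e a) (entry-avoiding e a av)
    (λ i j one → proj₁ (entry-one e a i j one))
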